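{- Let $M$ be a simple term containing no existential variables. (1) If $\Gamma;(\Omega,x{:}C);\Delta\vdash M\Uparrow A$, then $\Gamma;\Omega;\Delta\vdash M\Uparrow A$. (2) If $\Gamma;(\Omega,x{:}C);\Delta\vdash M\downarrow A$, then $\Gamma;\Omega;\Delta\vdash M\downarrow A$.
   Context: Strict $\lambda$-calculus over a signature $\Sigma$: labels $k\in\{1,0,u\}$, types $A::=a\mid A_1\to^kA_2$, terms $c\mid x\mid\lambda x^k{:}A.M\mid M_1M_2^k$. Contexts: finite sets of declarations with distinct variables; commas denote disjoint unions. Canonical ($\Uparrow$) and atomic ($\downarrow$) forms ($\Gamma$ unrestricted, $\Omega$ irrelevant, $\Delta$ strict; disjoint): $c{:}A\in\Sigma$ gives $\Gamma;\Omega;\cdot\vdash c\downarrow A$; $(\Gamma,x{:}A);\Omega;\cdot\vdash x\downarrow A$; $\Gamma;\Omega;x{:}A\vdash x\downarrow A$ (no rule for $\Omega$); $M\downarrow a$ ($a$ atomic) gives $M\Uparrow a$; from $(\Gamma,x{:}A);\Omega;\Delta\vdash M\Uparrow B$ infer $\Gamma;\Omega;\Delta\vdash\lambda x^u{:}A.M\Uparrow A\to^uB$; from $\Gamma;(\Omega,x{:}A);\Delta\vdash M\Uparrow B$ infer $\lambda x^0{:}A.M\Uparrow A\to^0B$; from $\Gamma;\Omega;(\Delta,x{:}A)\vdash M\Uparrow B$ infer $\lambda x^1{:}A.M\Uparrow A\to^1B$; from $\Gamma;\Omega;\Delta\vdash M\downarrow A\to^uB$ and $(\Gamma,\Delta);\Omega;\cdot\vdash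 N\Uparrow A$ infer $\Gamma;\Omega;\Delta\vdash MN^u\downarrow B$; from $\Gamma;\Omega;\Delta\vdash M\downarrow A\to^0B$ and $(\Gamma,\Omega,\Delta);\cdot;\cdot\vdash N\Uparrow A$ infer $\Gamma;\Omega;\Delta\vdash MN^0\downarrow B$; from $(\Gamma,\Delta_N);\Omega;\Delta_M\vdash M\downarrow A\to^1B$ and $(\Gamma,\Delta_M);\Omega;\Delta_N\vdash N\Uparrow A$ infer $\Gamma;\Omega;(\Delta_M,\Delta_N)\vdash MN^1\downarrow B$. Positive types $P::=a\mid N\to^1P$, negative types $N::=a\mid P\to^uN$. Simple terms (without existential variables): $M::=\lambda x^u{:}P.\,M\mid h\,M_1^1\dots M_n^1$ with $h$ a constant or variable, $n\ge0$. -}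

module Defs where

open import Data.Nat using (ℕ)
open import Data.Product using (_×_; _,_; proj₁)
open import Data.List using (List; []; _∷_; _++_; map; [_])
open import Data.List.Membership.Propositional using (_∈_; _∉_)
open import Data.List.Relation.Ternary.Interleaving.Propositional using (Interleaving)

data Lab : Set where
  one zero u : Lab

Atom : Set
Atom = ℕ

Const : Set
Const = ℕ

Var : Set
Var = ℕ

data Ty : Set where
  base : Atom → Ty
  arr  : Ty → Lab → Ty → Ty

-- Terms  c | x | λx^k:A.M | M₁ M₂^k   (no existential variables)
data Tm : Set where
  const : Const → Tm
  var   : Var → Tm
  lam   : Lab → Var → Ty → Tm → Tm
  app   : Tm → Tm → Lab → Tm

-- Signature and contexts: lists of declarations.  Lookup is by membership,
-- and disjoint union of strict contexts is expressed by an interleaving.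
Signature : Set
Signature = List (Const × Ty)

Ctx : Set
Ctx = List (Var × Ty)

dom : Ctx → List Var
dom = map proj₁

-- Canonical (⇑) and atomic (↓) forms:  Can Σ Γ Ω Δ M A  is  Γ;Ω;Δ ⊢ M ⇑ A.
data Can (Σ : Signature) : Ctx → Ctx → Ctx → Tm → Ty → Set
data At  (Σ : Signature) : Ctx → Ctx → Ctx → Tm → Ty → Set

data At Σ where
  at-const : ∀ {Γ Ω c A} → (c , A) ∈ Σ → At Σ Γ Ω [] (const c) A
  at-varu  : ∀ {Γ Ω x A} → (x , A) ∈ Γ → At Σ Γ Ω [] (var x) A
  at-var1  : ∀ {Γ Ω x A} → At Σ Γ Ω [ (x , A) ] (var x) A
  at-appu  : ∀ {Γ Ω Δ M N A B} →
             At Σ Γ Ω Δ M (arr A u B) → Can Σ (Γ ++ Δ) Ω [] N A →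
             At Σ Γ Ω Δ (app M N u) B
  at-app0  : ∀ {Γ Ω Δ M N A B} →
             At Σ Γ Ω Δ M (arr A zero B) → Can Σ (Γ ++ Ω ++ Δ) [] [] N A →
             At Σ Γ Ω Δ (app M N zero) B
  at-app1  : ∀ {Γ Ω Δ ΔM ΔN M N A B} → Interleaving ΔM ΔN Δ →
             At Σ (Γ ++ ΔN) Ω ΔM M (arr A one B) → Can Σ (Γ ++ ΔM) Ω ΔN N A →
             At Σ Γ Ω Δ (app M N one) B

data Can Σ where
  can-at   : ∀ {Γ Ω Δ M a} → At Σ Γ Ω Δ M (base a) → Can Σ Γ Ω Δ M (base a)
  can-lamu : ∀ {Γ Ω Δ x A M B} → x ∉ dom (Γ ++ Ω ++ Δ) →
             Can Σ ((x , A) ∷ Γ) Ω Δ M B → Can Σ Γ Ω Δ (lam u x A M) (arr A u B)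
  can-lam0 : ∀ {Γ Ω Δ x A M B} → x ∉ dom (Γ ++ Ω ++ Δ) →
             Can Σ Γ ((x , A) ∷ Ω) Δ M B → Can Σ Γ Ω Δ (lam zero x A M) (arr A zero B)
  can-lam1 : ∀ {Γ Ω Δ x A M B} → x ∉ dom (Γ ++ Ω ++ Δ) →
             Can Σ Γ Ω ((x , A) ∷ Δ) M B → Can Σ Γ Ω Δ (lam one x A M) (arr A one B)

data Pos : Ty → Set
data Neg : Ty → Set

data Pos where
  pos-base : ∀ {a} → Pos (base a)
  pos-arr  : ∀ {N P} → Neg N → Pos P → Pos (arr N one P)

data Neg where
  neg-base : ∀ {a} → Neg (base a)
  neg-arr  : ∀ {P N} → Pos P → Neg N → Neg (arr P u N)

data Simple : Tm → Set
data Spine  : Tm → Set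

data Spine where
  spine-const : ∀ {c} → Spine (const c)
  spine-var   : ∀ {x} → Spine (var x)
  spine-app   : ∀ {M N} → Spine M → Simple N → Spine (app M N one)

data Simple where
  simple-spine : ∀ {M} → Spine M → Simple M
  simple-lam   : ∀ {x P M} → Pos P → Simple M → Simple (lam u x P M)

{-# OPTIONS --safe #-}
module Submission where

-- Simple terms contain neither λ⁰ nor applications with label 0, so the
-- irrelevant context Ω is never consulted by their derivations: the variable
-- rules look only at Γ, Δ and Σ, and Ω merely appears in the freshness side
-- conditions of λᵘ, which become weaker as Ω shrinks.

open import Defs
open import Function using (_∘_)
open import Data.Product using (_×_; _,_)
open import Data.List using (_∷_; _++_)
open import Data.List.Relation.Unary.Unique.Propositional using (Unique)
open import Data.List.Membership.Propositional using (_∉_)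
open import Data.List.Relation.Binary.Subset.Propositional using (_⊆_)
open import Data.List.Relation.Binary.Subset.Propositional.Properties
  using (⊆-refl; ++⁺; ++⁺ʳ; map⁺; xs⊆x∷xs)

module _ {Σ : Signature} where

  fresh-⊆ : ∀ {Γ Ω Ω′ Δ y} → Ω′ ⊆ Ω →
            y ∉ dom (Γ ++ Ω ++ Δ) → y ∉ dom (Γ ++ Ω′ ++ Δ)
  fresh-⊆ {Γ} Ω′⊆Ω y∉ = y∉ ∘ map⁺ _ (++⁺ʳ Γ (++⁺ Ω′⊆Ω ⊆-refl))

  can-shrink-irrelevant : ∀ {Γ Ω Ω′ Δ M A} → Simple M → Ω′ ⊆ Ω →
                          Can Σ Γ Ω Δ M A → Can Σ Γ Ω′ Δ M A
  at-shrink-irrelevant  : ∀ {Γ Ω Ω′ Δ M A} → Spine M → Ω′ ⊆ Ω →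
                          At Σ Γ Ω Δ M A → At Σ Γ Ω′ Δ M A

  can-shrink-irrelevant (simple-spine s) Ω′⊆Ω (can-at d) =
    can-at (at-shrink-irrelevant s Ω′⊆Ω d)
  can-shrink-irrelevant {Γ} (simple-lam _ m) Ω′⊆Ω (can-lamu y∉ d) =
    can-lamu (fresh-⊆ {Γ} Ω′⊆Ω y∉) (can-shrink-irrelevant m Ω′⊆Ω d)
  can-shrink-irrelevant (simple-spine ()) _ (can-lamu _ _)
  can-shrink-irrelevant (simple-spine ()) _ (can-lam0 _ _)
  can-shrink-irrelevant (simple-spine ()) _ (can-lam1 _ _)

  at-shrink-irrelevant _ _ (at-const c∈Σ) = at-const c∈Σ
  at-shrink-irrelevant _ _ (at-varu x∈Γ)  = at-varu x∈Γ
  at-shrink-irrelevant _ _ at-var1        = at-var1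
  at-shrink-irrelevant (spine-app s n) Ω′⊆Ω (at-app1 i d e) =
    at-app1 i (at-shrink-irrelevant s Ω′⊆Ω d) (can-shrink-irrelevant n Ω′⊆Ω e)

  simple-at⇒spine : ∀ {Γ Ω Δ M A} → Simple M → At Σ Γ Ω Δ M A → Spine M
  simple-at⇒spine (simple-spine s) _ = s
  simple-at⇒spine (simple-lam _ _) ()

lemma5p6 : (Σ : Signature) (Γ Ω Δ : Ctx) (x : Var) (C : Ty) (M : Tm) (A : Ty) →
    Simple M →
    Unique (dom (Γ ++ ((x , C) ∷ Ω) ++ Δ)) →
    (Can Σ Γ ((x , C) ∷ Ω) Δ M A → Can Σ Γ Ω Δ M A)
    × (At Σ Γ ((x , C) ∷ Ω) Δ M A → At Σ Γ Ω Δ M A)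
lemma5p6 Σ Γ Ω Δ x C M A m _ =
    can-shrink-irrelevant m Ω⊆xΩ
  , λ d → at-shrink-irrelevant (simple-at⇒spine m d) Ω⊆xΩ d
  where
  Ω⊆xΩ : Ω ⊆ (x , C) ∷ Ω
  Ω⊆xΩ = xs⊆x∷xs Ω (x , C)
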